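{- Let $p$ be a prime with $p\equiv 1 \pmod 3$ and $\mathcal{R}=\mathbb{F}_p+u\mathbb{F}_p+u^2\mathbb{F}_p+u^3\mathbb{F}_p$ with $u^4=u$. Let $\varrho:\mathcal{R}^n\to\mathcal{R}^n$ be the $(1-2u^3)$-constacyclic shift $\varrho(r_0,\dots,r_{n-1})=((1-2u^3)r_{n-1},r_0,\dots,r_{n-2})$, let $\sigma$ be the cyclic shift on $\mathbb{F}_p^{2n}$, $\sigma(v_0,\dots,v_{2n-1})=(v_{2n-1},v_0,\dots,v_{2n-2})$, and let $\Phi:\mathcal{R}^n\to\mathbb{F}_p^{2n}$ be the Gray map $$(r_0,\dots,r_{n-1})\mapsto(-d_0,\dots,-d_{n-1},\,2a_0+d_0,\dots,2a_{n-1}+d_{n-1}),\qquad r_i=a_i+b_iu+c_iu^2+d_iu^3 .$$ Then $\Phi\circ\varrho=\sigma\circ\Phi$.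
   Context: $\mathcal{R}=\mathbb{F}_p[u]/\langle u^4-u\rangle$; every element of $\mathcal{R}$ is uniquely $a+bu+cu^2+du^3$ with $a,b,c,d\in\mathbb{F}_p$. -}

module Defs where

open import Data.Nat as ℕ using (ℕ; NonZero; _∸_)
open import Data.Nat.DivMod using (_%_; m%n<n)
open import Data.Fin using (Fin; toℕ; fromℕ<)
open import Data.Vec using (Vec; []; _∷_; _++_; map; last; init)

shiftBy : ∀ {A : Set} {k : ℕ} → (A → A) → Vec A k → Vec A k
shiftBy f []       = []
shiftBy f (x ∷ xs) = f (last (x ∷ xs)) ∷ init (x ∷ xs)

module Setup (p : ℕ) .{{_ : NonZero p}} where

  𝔽 : Set
  𝔽 = Fin p

  ⟦_⟧ : ℕ → 𝔽
  ⟦ x ⟧ = fromℕ< (m%n<n x p)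

  infixl 6 _+ₚ_
  infixl 7 _*ₚ_
  _+ₚ_ : 𝔽 → 𝔽 → 𝔽
  x +ₚ y = ⟦ toℕ x ℕ.+ toℕ y ⟧

  _*ₚ_ : 𝔽 → 𝔽 → 𝔽
  x *ₚ y = ⟦ toℕ x ℕ.* toℕ y ⟧

  -ₚ_ : 𝔽 → 𝔽
  -ₚ x = ⟦ p ∸ toℕ x ⟧

  0ₚ 1ₚ 2ₚ : 𝔽
  0ₚ = ⟦ 0 ⟧
  1ₚ = ⟦ 1 ⟧
  2ₚ = ⟦ 2 ⟧

  -- The ring R = 𝔽_p[u]/⟨u⁴ - u⟩; ⟨ a , b , c , d ⟩ stands for a + b u + c u² + d u³.
  record R : Set where
    constructor ⟨_,_,_,_⟩
    field
      a b c d : 𝔽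
  open R public

  -- Multiplication in R (polynomial product, reduced by u⁴ = u, u⁵ = u², u⁶ = u³).
  _*R_ : R → R → R
  ⟨ a₁ , b₁ , c₁ , d₁ ⟩ *R ⟨ a₂ , b₂ , c₂ , d₂ ⟩ =
    ⟨ a₁ *ₚ a₂
    , a₁ *ₚ b₂ +ₚ b₁ *ₚ a₂ +ₚ (b₁ *ₚ d₂ +ₚ c₁ *ₚ c₂ +ₚ d₁ *ₚ b₂)
    , a₁ *ₚ c₂ +ₚ b₁ *ₚ b₂ +ₚ c₁ *ₚ a₂ +ₚ (c₁ *ₚ d₂ +ₚ d₁ *ₚ c₂)
    , a₁ *ₚ d₂ +ₚ b₁ *ₚ c₂ +ₚ c₁ *ₚ b₂ +ₚ d₁ *ₚ a₂ +ₚ d₁ *ₚ d₂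
    ⟩

  λ₀ : R
  λ₀ = ⟨ 1ₚ , 0ₚ , 0ₚ , -ₚ 2ₚ ⟩

  ϱ : ∀ {n} → Vec R n → Vec R n
  ϱ = shiftBy (λ₀ *R_)

  σ : ∀ {n} → Vec 𝔽 (n ℕ.+ n) → Vec 𝔽 (n ℕ.+ n)
  σ = shiftBy (λ v → v)

  Φ : ∀ {n} → Vec R n → Vec 𝔽 (n ℕ.+ n)
  Φ rs = map (λ r → -ₚ d r) rs ++ map (λ r → 2ₚ *ₚ a r +ₚ d r) rs

module Submission where

-- Write Φ(r) = g(r) ++ h(r) with g(r) = -d and h(r) = 2a + d, applied
-- coordinatewise.  Shifting r twists only the last coordinate, by λ = 1 - 2u³,
-- so it suffices that g ∘ (λ ·_) = h and h ∘ (λ ·_) = g: then the last entry of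
-- the h-block moves to the front and the last entry of the g-block moves to
-- the head of the h-block, which is exactly σ.
--
-- The two coordinate identities are plain arithmetic: λ·(a + bu + cu² + du³)
-- has u⁰-coefficient a and u³-coefficient d - 2a - 2d, and both identities
-- reduce to (a + d)(2 + (-2)) = 0.

open import Defs
open import Data.Nat using (ℕ; suc; NonZero; >-nonZero⁻¹; _+_; _*_; _∸_)
open import Data.Nat.DivMod using (_%_; m%n<n; m%n%n≡m%n; n%n≡0; m<n⇒m%n≡m; %-distribˡ-+; %-distribˡ-*)
open import Data.Nat.Properties using (m∸n+n≡m; <⇒≤; +-comm; +-assoc; +-identityʳ)
open import Data.Nat.Primality using (Prime)
open import Data.Nat.Tactic.RingSolver using (solve-∀)
open import Data.Fin using (toℕ)
open import Data.Fin.Properties using (toℕ-fromℕ<; toℕ-injective; toℕ<n)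
open import Data.Vec using (Vec; []; _∷_; _++_; map; last; init)
open import Function using (id)
open import Relation.Binary.PropositionalEquality
  using (_≡_; refl; sym; trans; cong; cong₂; module ≡-Reasoning)

init-++ : ∀ {A : Set} {k j} x (xs : Vec A k) (zs : Vec A (suc j)) →
          init (x ∷ (xs ++ zs)) ≡ init (x ∷ xs) ++ (last (x ∷ xs) ∷ init zs)
init-++ x []       (z ∷ zs) = refl
init-++ x (y ∷ xs) zs       = cong (x ∷_) (init-++ y xs zs)

last-++ : ∀ {A : Set} {k j} x (xs : Vec A k) (zs : Vec A (suc j)) →
          last (x ∷ (xs ++ zs)) ≡ last zs
last-++ x []       (z ∷ zs) = refl
last-++ x (y ∷ xs) zs       = last-++ y xs zs

init-map : ∀ {A B : Set} {k} (f : A → B) (v : Vec A (suc k)) →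
           init (map f v) ≡ map f (init v)
init-map f (x ∷ [])     = refl
init-map f (x ∷ y ∷ v) = cong (f x ∷_) (init-map f (y ∷ v))

last-map : ∀ {A B : Set} {k} (f : A → B) (v : Vec A (suc k)) →
           last (map f v) ≡ f (last v)
last-map f (x ∷ [])     = refl
last-map f (x ∷ y ∷ v) = last-map f (y ∷ v)

twisted-shift-intertwines :
  ∀ {A B : Set} {n} (f : A → A) (g h : A → B) →
  (∀ x → g (f x) ≡ h x) → (∀ x → h (f x) ≡ g x) → (v : Vec A n) →
  map g (shiftBy f v) ++ map h (shiftBy f v) ≡ shiftBy id (map g v ++ map h v)
twisted-shift-intertwines f g h gf≡h hf≡g []       = refl
twisted-shift-intertwines f g h gf≡h hf≡g (x ∷ xs) = cong₂ _∷_ head-entry tail-entries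
  where
    open ≡-Reasoning
    v = x ∷ xs

    head-entry : g (f (last v)) ≡ last (g x ∷ (map g xs ++ map h v))
    head-entry = begin
      g (f (last v))                     ≡⟨ gf≡h (last v) ⟩
      h (last v)                         ≡⟨ sym (last-map h v) ⟩
      last (map h v)                     ≡⟨ sym (last-++ (g x) (map g xs) (map h v)) ⟩
      last (g x ∷ (map g xs ++ map h v)) ∎

    tail-entries : map g (init v) ++ (h (f (last v)) ∷ map h (init v))
                 ≡ init (g x ∷ (map g xs ++ map h v))
    tail-entries = begin
      map g (init v) ++ (h (f (last v)) ∷ map h (init v))
        ≡⟨ cong₂ (λ s t → map g (init v) ++ (s ∷ t)) (hf≡g (last v)) (sym (init-map h v)) ⟩
      map g (init v) ++ (g (last v) ∷ init (map h v))
        ≡⟨ cong₂ (λ s t → s ++ (t ∷ init (map h v))) (sym (init-map g v)) (sym (last-map g v)) ⟩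
      init (map g v) ++ (last (map g v) ∷ init (map h v))
        ≡⟨ sym (init-++ (g x) (map g xs) (map h v)) ⟩
      init (g x ∷ (map g xs ++ map h v)) ∎

module Residues (p : ℕ) .{{_ : NonZero p}} where
  open Setup p

  infix 4 _≈_
  _≈_ : ℕ → ℕ → Set
  x ≈ y = x % p ≡ y % p

  ≈-refl : ∀ {x} → x ≈ x
  ≈-refl = refl

  ≈-trans : ∀ {x y z} → x ≈ y → y ≈ z → x ≈ z
  ≈-trans = trans

  ≡⇒≈ : ∀ {x y} → x ≡ y → x ≈ y
  ≡⇒≈ = cong (_% p)

  +-cong : ∀ {x x′ y y′} → x ≈ x′ → y ≈ y′ → x + y ≈ x′ + y′
  +-cong {x} {x′} {y} {y′} e f = begin
    (x + y) % p                 ≡⟨ %-distribˡ-+ x y p ⟩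
    (x % p + y % p) % p         ≡⟨ cong₂ (λ s t → (s + t) % p) e f ⟩
    (x′ % p + y′ % p) % p       ≡⟨ sym (%-distribˡ-+ x′ y′ p) ⟩
    (x′ + y′) % p               ∎
    where open ≡-Reasoning

  *-cong : ∀ {x x′ y y′} → x ≈ x′ → y ≈ y′ → x * y ≈ x′ * y′
  *-cong {x} {x′} {y} {y′} e f = begin
    (x * y) % p                 ≡⟨ %-distribˡ-* x y p ⟩
    (x % p * (y % p)) % p       ≡⟨ cong₂ (λ s t → (s * t) % p) e f ⟩
    (x′ % p * (y′ % p)) % p     ≡⟨ sym (%-distribˡ-* x′ y′ p) ⟩
    (x′ * y′) % p               ∎
    where open ≡-Reasoning

  p≈0 : p ≈ 0
  p≈0 = trans (n%n≡0 p) (sym (m<n⇒m%n≡m (>-nonZero⁻¹ p)))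

  ≈⇒≡ : ∀ {x y : 𝔽} → toℕ x ≈ toℕ y → x ≡ y
  ≈⇒≡ {x} {y} e = toℕ-injective
    (trans (sym (m<n⇒m%n≡m (toℕ<n x))) (trans e (m<n⇒m%n≡m (toℕ<n y))))

  toℕ-lit : ∀ k → toℕ ⟦ k ⟧ ≈ k
  toℕ-lit k = trans (cong (_% p) (toℕ-fromℕ< (m%n<n k p))) (m%n%n≡m%n k p)

  toℕ-+ : ∀ {x y X Y} → toℕ x ≈ X → toℕ y ≈ Y → toℕ (x +ₚ y) ≈ X + Y
  toℕ-+ {x} {y} e f = ≈-trans (toℕ-lit (toℕ x + toℕ y)) (+-cong e f)

  toℕ-* : ∀ {x y X Y} → toℕ x ≈ X → toℕ y ≈ Y → toℕ (x *ₚ y) ≈ X * Y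
  toℕ-* {x} {y} e f = ≈-trans (toℕ-lit (toℕ x * toℕ y)) (*-cong e f)

  neg-inverse : ∀ x → toℕ (-ₚ x) + toℕ x ≈ 0
  neg-inverse x = ≈-trans (+-cong (toℕ-lit (p ∸ toℕ x)) (≈-refl {toℕ x}))
                          (≈-trans (≡⇒≈ (m∸n+n≡m (<⇒≤ (toℕ<n x)))) p≈0)

  neg-unique : ∀ {x y} → toℕ y + toℕ x ≈ 0 → -ₚ x ≡ y
  neg-unique {x} {y} y+x≈0 = ≈⇒≡ (begin
    N (-ₚ x) % p                   ≡⟨ ≡⇒≈ (sym (+-identityʳ (N (-ₚ x)))) ⟩
    (N (-ₚ x) + 0) % p             ≡⟨ +-cong (≈-refl {N (-ₚ x)}) (sym y+x≈0) ⟩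
    (N (-ₚ x) + (N y + N x)) % p   ≡⟨ ≡⇒≈ (cong (N (-ₚ x) +_) (+-comm (N y) (N x))) ⟩
    (N (-ₚ x) + (N x + N y)) % p   ≡⟨ ≡⇒≈ (sym (+-assoc (N (-ₚ x)) (N x) (N y))) ⟩
    (N (-ₚ x) + N x + N y) % p     ≡⟨ +-cong (neg-inverse x) (≈-refl {N y}) ⟩
    N y % p                        ∎)
    where
      open ≡-Reasoning
      N = toℕ

module UnitAction (p : ℕ) .{{_ : NonZero p}} where
  open Setup p
  open Residues p

  module _ (r : R) where
    A = toℕ (a r)
    B = toℕ (b r)
    C = toℕ (c r)
    D = toℕ (d r)
    M = toℕ (-ₚ 2ₚ)

    a-of-λ : toℕ (a (λ₀ *R r)) ≈ 1 * A
    a-of-λ = toℕ-* (toℕ-lit 1) ≈-refl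

    d-of-λ : toℕ (d (λ₀ *R r)) ≈ 1 * D + 0 * C + 0 * B + M * A + M * D
    d-of-λ = toℕ-+ (toℕ-+ (toℕ-+ (toℕ-+ (toℕ-* (toℕ-lit 1) ≈-refl)
                                          (toℕ-* (toℕ-lit 0) ≈-refl))
                                  (toℕ-* (toℕ-lit 0) ≈-refl))
                          (toℕ-* {x = -ₚ 2ₚ} {y = a r} ≈-refl ≈-refl))
                   (toℕ-* {x = -ₚ 2ₚ} {y = d r} ≈-refl ≈-refl)

    vanishing : (M + 2) * (A + D) ≈ 0
    vanishing = *-cong (≈-trans (+-cong (≈-refl {M}) (sym (toℕ-lit 2))) (neg-inverse 2ₚ))
                       (≈-refl {A + D})

    g-swap : -ₚ d (λ₀ *R r) ≡ 2ₚ *ₚ a r +ₚ d r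
    g-swap = neg-unique (≈-trans (+-cong (toℕ-+ (toℕ-* (toℕ-lit 2) ≈-refl) ≈-refl) d-of-λ)
                                 (≈-trans (≡⇒≈ (regroup A B C D M)) vanishing))
      where
        regroup : ∀ A B C D M → (2 * A + D) + (1 * D + 0 * C + 0 * B + M * A + M * D)
                                ≡ (M + 2) * (A + D)
        regroup = solve-∀

    h-swap : 2ₚ *ₚ a (λ₀ *R r) +ₚ d (λ₀ *R r) ≡ -ₚ d r
    h-swap = sym (neg-unique (≈-trans (+-cong (toℕ-+ (toℕ-* (toℕ-lit 2) a-of-λ) d-of-λ) ≈-refl)
                                      (≈-trans (≡⇒≈ (regroup A B C D M)) vanishing)))
      where
        regroup : ∀ A B C D M → (2 * (1 * A) + (1 * D + 0 * C + 0 * B + M * A + M * D)) + D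
                                ≡ (M + 2) * (A + D)
        regroup = solve-∀

theorem1 : (p : ℕ) .{{_ : NonZero p}} → Prime p → p % 3 ≡ 1 →
           (n : ℕ) (r : Vec (Setup.R p) n) →
           Setup.Φ p (Setup.ϱ p r) ≡ Setup.σ p {n} (Setup.Φ p r)
theorem1 p _ _ n r =
  twisted-shift-intertwines (λ₀ *R_) (λ s → -ₚ d s) (λ s → 2ₚ *ₚ a s +ₚ d s) g-swap h-swap r
  where
    open Setup p
    open UnitAction p
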